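{- Let $\Gamma$ and $\Delta$ be finite simple graphs, and let $\pi=\{C_1,\dots,C_t\}$ be a partition of $V(\Gamma)$. For $w\in V(\Delta)$ put $C_i^{(w)}=C_i\times\{w\}$ and let $\Pi=\{C_i^{(w)} \mid i\in[t],\ w\in V(\Delta)\}$, a partition of $V(\Gamma)\times V(\Delta)$. If $\pi$ is an equitable partition of $\Gamma$, then $\Pi$ is an equitable partition of the product graph $\Gamma\star\Delta$, for the product $\star$ of any type $[0s_{01}s_{02};s_{10}s_{11}s_{12};s_{20}s_{21}s_{22}]$ with all $s_{ij}\in\{0,1\}$.
   Context: A partition $\{C_1,\dots,C_t\}$ of the vertex set of a graph is equitable if for all $i,j$, any two vertices in $C_i$ have the same number of neighbours in $C_j$. Graph products of a given type: for graphs $\Gamma,\Delta$ set $A_0=I_{|V(\Gamma)|}$, $A_1=A(\Gamma)$, $A_2=J-I-A(\Gamma)$, $B_0=I_{|V(\Delta)|}$, $B_1=A(\Delta)$, $B_2=J-I-A(\Delta)$, where $A(\cdot)$ is the adjacency matrix, $J$ the all-ones matrix and $I$ the identity. Given $s_{ij}\in\{0,1\}$ ($i,j\in\{0,1,2\}$) with $s_{00}=0$, the product $\Gamma\star\Delta$ is the simple graph on $V(\Gamma)\times V(\Delta)$ with adjacency matrix $\sum_{i,j\in\{0,1,2\}} s_{ij}(A_i\otimes B_j)$ (Kronecker/tensor product of matrices, rows/columns indexed by pairs $(x,w)$). The sequence $[0s_{01}s_{02};s_{10}s_{11}s_{12};s_{20}s_{21}s_{22}]$ is called the type of the product. -}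

module Defs where

open import Data.Nat using (ℕ; zero; suc; _+_; _*_)
open import Data.Bool using (Bool; true; false; if_then_else_)
open import Data.Fin using (Fin; zero; suc; combine; remQuot)
open import Data.Fin.Properties using (_≟_)
open import Data.Product using (Σ; _×_; _,_)
open import Relation.Nullary using (does)
open import Relation.Binary.PropositionalEquality using (_≡_)

record Graph : Set where
  field
    n     : ℕ
    adj   : Fin n → Fin n → Bool
    sym   : ∀ x y → adj x y ≡ adj y x
    loopless : ∀ x → adj x x ≡ false
open Graph public

Matrix : ℕ → Set
Matrix N = Fin N → Fin N → ℕ

ΣFin : (N : ℕ) → (Fin N → ℕ) → ℕ
ΣFin zero    f = 0
ΣFin (suc N) f = f zero + ΣFin N (λ i → f (suc i))

b2n : Bool → ℕ
b2n true  = 1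
b2n false = 0

I : (N : ℕ) → Matrix N
I N x y = b2n (does (x ≟ y))

J : (N : ℕ) → Matrix N
J N x y = 1

A : (Γ : Graph) → Matrix (n Γ)
A Γ x y = b2n (adj Γ x y)

-- J - I - A(Γ)  (entries computed pointwise; they are 0/1)
Ā : (Γ : Graph) → Matrix (n Γ)
Ā Γ x y = if does (x ≟ y) then 0 else (if adj Γ x y then 0 else 1)

Mat : (Γ : Graph) → Fin 3 → Matrix (n Γ)
Mat Γ zero             = I (n Γ)
Mat Γ (suc zero)       = A Γ
Mat Γ (suc (suc zero)) = Ā Γ

-- Kronecker product; row/column (x,w) of V(Γ)×V(Δ) is encoded as combine x w : Fin (n*m).
_⊗_ : ∀ {n m} → Matrix n → Matrix m → Matrix (n * m)
_⊗_ {n} {m} P Q u v with remQuot {n} m u | remQuot {n} m v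
... | x , w | y , z = P x y * Q w z

Type : Set
Type = Fin 3 → Fin 3 → Bool

productMatrix : Type → (Γ Δ : Graph) → Matrix (n Γ * n Δ)
productMatrix s Γ Δ u v =
  ΣFin 3 (λ i → ΣFin 3 (λ j → b2n (s i j) * (Mat Γ i ⊗ Mat Δ j) u v))

-- A partition into t cells, given by a cell-assignment map that is surjective
-- (so every cell is nonempty).
IsPartition : ∀ {N t} → (Fin N → Fin t) → Set
IsPartition {N} {t} c = ∀ (i : Fin t) → Σ (Fin N) (λ x → c x ≡ i)

nbrsIn : ∀ {N t} → Matrix N → (Fin N → Fin t) → Fin N → Fin t → ℕ
nbrsIn {N} M c u j = ΣFin N (λ v → M u v * b2n (does (c v ≟ j)))

IsEquitable : ∀ {N t} → Matrix N → (Fin N → Fin t) → Set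
IsEquitable {N} {t} M c =
  ∀ (i j : Fin t) (x y : Fin N) → c x ≡ i → c y ≡ i → nbrsIn M c x j ≡ nbrsIn M c y j

IsEquitablePartition : ∀ {N t} → Matrix N → (Fin N → Fin t) → Set
IsEquitablePartition M c = IsPartition c × IsEquitable M c

-- The partition Π = {C_i × {w}} of V(Γ)×V(Δ), with cells indexed by (i,w) ↦ combine i w.
liftPartition : ∀ {n m t} → (Fin n → Fin t) → Fin (n * m) → Fin (t * m)
liftPartition {n} {m} {t} c u with remQuot {n} m u
... | x , w = combine (c x) w

-- For a fixed partition c, a matrix M is equitable when the counts nbrsIn M c x j depend on
-- x only through its cell.  These counts are linear in M, so equitable matrices are closed
-- under sums, scalar multiples and cancellation of an equitable summand; I and J are
-- equitable for every partition, hence so is J - I - A(Γ) whenever A(Γ) is.  In a Kronecker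
-- product P ⊗ Q the vertex (x,w) has (nbrsIn P c x j) · Q[w][z] neighbours in C_j × {z},
-- again a function of the cell of x; and the product graph's matrix is a nonnegative
-- combination of the Kronecker products A_i ⊗ B_j.
module Submission where

open import Defs hiding (sym)
open import Data.Nat using (ℕ; zero; suc; _+_; _*_)
open import Data.Nat.Properties
  using (+-identityʳ; *-identityʳ; *-zeroʳ; *-assoc; *-distribˡ-+; *-distribʳ-+; *-comm;
         +-assoc; +-cancelʳ-≡; +-commutativeSemigroup; *-commutativeSemigroup)
open import Algebra.Properties.CommutativeSemigroup +-commutativeSemigroup
  using () renaming (interchange to +-interchange)
open import Algebra.Properties.CommutativeSemigroup *-commutativeSemigroup
  using () renaming (interchange to *-interchange)
open import Data.Fin using (Fin; zero; suc; combine; _↑ˡ_; _↑ʳ_)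
open import Data.Fin.Properties
  using (remQuot-combine; combine-surjective; combine-injective; combine-injectiveˡ; combine-injectiveʳ)
  renaming (_≟_ to _≟ᶠ_)
open import Data.Bool using (true; false)
open import Data.Product using (_×_; _,_; proj₁; proj₂)
open import Data.Empty using (⊥-elim)
open import Function using (_∘_)
open import Relation.Nullary using (does; yes; no; ¬_)
open import Relation.Binary.PropositionalEquality
  using (_≡_; refl; sym; trans; cong; cong₂; module ≡-Reasoning)
open ≡-Reasoning

ΣFin-cong : ∀ N {f g : Fin N → ℕ} → (∀ i → f i ≡ g i) → ΣFin N f ≡ ΣFin N g
ΣFin-cong zero    f≗g = refl
ΣFin-cong (suc N) f≗g = cong₂ _+_ (f≗g zero) (ΣFin-cong N (f≗g ∘ suc))

ΣFin-+ : ∀ N (f g : Fin N → ℕ) → ΣFin N (λ i → f i + g i) ≡ ΣFin N f + ΣFin N g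
ΣFin-+ zero    f g = refl
ΣFin-+ (suc N) f g = trans (cong (f zero + g zero +_) (ΣFin-+ N (f ∘ suc) (g ∘ suc)))
  (+-interchange (f zero) (g zero) _ _)

ΣFin-*ˡ : ∀ N k (f : Fin N → ℕ) → ΣFin N (λ i → k * f i) ≡ k * ΣFin N f
ΣFin-*ˡ zero    k f = sym (*-zeroʳ k)
ΣFin-*ˡ (suc N) k f = trans (cong (k * f zero +_) (ΣFin-*ˡ N k (f ∘ suc)))
  (sym (*-distribˡ-+ k (f zero) _))

ΣFin-*ʳ : ∀ N k (f : Fin N → ℕ) → ΣFin N (λ i → f i * k) ≡ ΣFin N f * k
ΣFin-*ʳ N k f = trans (ΣFin-cong N (λ i → *-comm (f i) k))
  (trans (ΣFin-*ˡ N k f) (*-comm k _))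

ΣFin-zero : ∀ N → ΣFin N (λ _ → 0) ≡ 0
ΣFin-zero N = ΣFin-*ˡ N 0 (λ _ → 0)

ΣFin-*-ΣFin : ∀ N M (f : Fin N → ℕ) (g : Fin M → ℕ) →
  ΣFin N (λ y → ΣFin M (λ z → f y * g z)) ≡ ΣFin N f * ΣFin M g
ΣFin-*-ΣFin N M f g = trans (ΣFin-cong N (λ y → ΣFin-*ˡ M (f y) g)) (ΣFin-*ʳ N (ΣFin M g) f)

ΣFin-↑ : ∀ a b (f : Fin (a + b) → ℕ) →
  ΣFin (a + b) f ≡ ΣFin a (λ i → f (i ↑ˡ b)) + ΣFin b (λ j → f (a ↑ʳ j))
ΣFin-↑ zero    b f = refl
ΣFin-↑ (suc a) b f = trans (cong (f zero +_) (ΣFin-↑ a b (f ∘ suc)))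
  (sym (+-assoc (f zero) _ _))

ΣFin-combine : ∀ N M (f : Fin (N * M) → ℕ) →
  ΣFin (N * M) f ≡ ΣFin N (λ y → ΣFin M (λ z → f (combine y z)))
ΣFin-combine zero    M f = refl
ΣFin-combine (suc N) M f = trans (ΣFin-↑ M (N * M) f)
  (cong (ΣFin M (λ z → f (z ↑ˡ (N * M))) +_) (ΣFin-combine N M (f ∘ (M ↑ʳ_))))

δ : ∀ {N} → Fin N → Fin N → ℕ
δ x y = b2n (does (x ≟ᶠ y))

δ-refl : ∀ {N} (x : Fin N) → δ x x ≡ 1
δ-refl x with x ≟ᶠ x
... | yes _   = refl
... | no x≢x  = ⊥-elim (x≢x refl)

δ-≢ : ∀ {N} {x y : Fin N} → ¬ x ≡ y → δ x y ≡ 0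
δ-≢ {x = x} {y} x≢y with x ≟ᶠ y
... | yes x≡y = ⊥-elim (x≢y x≡y)
... | no _    = refl

δ-combine : ∀ {N M} (a a′ : Fin N) (b b′ : Fin M) →
  δ (combine a b) (combine a′ b′) ≡ δ a a′ * δ b b′
δ-combine a a′ b b′ with a ≟ᶠ a′ | b ≟ᶠ b′
... | yes refl | yes refl = δ-refl (combine a b)
... | yes _    | no b≢b′  = δ-≢ (b≢b′ ∘ combine-injectiveʳ a b a′ b′)
... | no a≢a′  | _        = δ-≢ (a≢a′ ∘ combine-injectiveˡ a b a′ b′)

δ-sumˡ : ∀ N (x : Fin N) (h : Fin N → ℕ) → ΣFin N (λ y → δ x y * h y) ≡ h x
δ-sumˡ (suc N) zero    h = trans (cong₂ _+_ (+-identityʳ (h zero)) (ΣFin-zero N))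
  (+-identityʳ (h zero))
δ-sumˡ (suc N) (suc x) h = δ-sumˡ N x (h ∘ suc)

δ-sumʳ : ∀ N (x : Fin N) (h : Fin N → ℕ) → ΣFin N (λ y → h y * δ y x) ≡ h x
δ-sumʳ (suc N) zero    h = trans (cong₂ _+_ (*-identityʳ (h zero)) vanish) (+-identityʳ (h zero))
  where
  vanish : ΣFin N (λ y → h (suc y) * 0) ≡ 0
  vanish = trans (ΣFin-*ʳ N 0 (h ∘ suc)) (*-zeroʳ (ΣFin N (h ∘ suc)))
δ-sumʳ (suc N) (suc x) h =
  trans (cong (_+ ΣFin N (λ y → h (suc y) * δ y x)) (*-zeroʳ (h zero))) (δ-sumʳ N x (h ∘ suc))

_+ᴹ_ : ∀ {N} → Matrix N → Matrix N → Matrix N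
(M +ᴹ M′) u v = M u v + M′ u v

_·ᴹ_ : ∀ {N} → ℕ → Matrix N → Matrix N
(k ·ᴹ M) u v = k * M u v

Σᴹ : ∀ {N} k → (Fin k → Matrix N) → Matrix N
Σᴹ k M u v = ΣFin k (λ i → M i u v)

module _ {N t : ℕ} (c : Fin N → Fin t) where

  nbrsIn-cong : ∀ {M M′ : Matrix N} → (∀ u v → M u v ≡ M′ u v) →
    ∀ x j → nbrsIn M c x j ≡ nbrsIn M′ c x j
  nbrsIn-cong M≗M′ x j = ΣFin-cong N (λ v → cong (_* _) (M≗M′ x v))

  nbrsIn-+ : ∀ (M M′ : Matrix N) x j →
    nbrsIn (M +ᴹ M′) c x j ≡ nbrsIn M c x j + nbrsIn M′ c x j
  nbrsIn-+ M M′ x j = trans (ΣFin-cong N (λ v → *-distribʳ-+ _ (M x v) (M′ x v))) (ΣFin-+ N _ _)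

  nbrsIn-· : ∀ k (M : Matrix N) x j → nbrsIn (k ·ᴹ M) c x j ≡ k * nbrsIn M c x j
  nbrsIn-· k M x j = trans (ΣFin-cong N (λ v → *-assoc k (M x v) _)) (ΣFin-*ˡ N k _)

  IsEquitable-cong : ∀ {M M′ : Matrix N} → (∀ u v → M u v ≡ M′ u v) →
    IsEquitable M c → IsEquitable M′ c
  IsEquitable-cong {M} {M′} M≗M′ eqM i j x y cx cy = begin
    nbrsIn M′ c x j ≡⟨ nbrsIn-cong M≗M′ x j ⟨
    nbrsIn M c x j  ≡⟨ eqM i j x y cx cy ⟩
    nbrsIn M c y j  ≡⟨ nbrsIn-cong M≗M′ y j ⟩
    nbrsIn M′ c y j ∎

  IsEquitable-+ : ∀ (M M′ : Matrix N) → IsEquitable M c → IsEquitable M′ c →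
    IsEquitable (M +ᴹ M′) c
  IsEquitable-+ M M′ eqM eqM′ i j x y cx cy = begin
    nbrsIn (M +ᴹ M′) c x j        ≡⟨ nbrsIn-+ M M′ x j ⟩
    nbrsIn M c x j + nbrsIn M′ c x j ≡⟨ cong₂ _+_ (eqM i j x y cx cy) (eqM′ i j x y cx cy) ⟩
    nbrsIn M c y j + nbrsIn M′ c y j ≡⟨ nbrsIn-+ M M′ y j ⟨
    nbrsIn (M +ᴹ M′) c y j        ∎

  IsEquitable-+-cancelʳ : ∀ (M M′ : Matrix N) → IsEquitable (M +ᴹ M′) c → IsEquitable M′ c →
    IsEquitable M c
  IsEquitable-+-cancelʳ M M′ eqMM′ eqM′ i j x y cx cy =
    +-cancelʳ-≡ (nbrsIn M′ c y j) (nbrsIn M c x j) (nbrsIn M c y j) (begin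
      nbrsIn M c x j + nbrsIn M′ c y j ≡⟨ cong (_ +_) (eqM′ i j x y cx cy) ⟨
      nbrsIn M c x j + nbrsIn M′ c x j ≡⟨ nbrsIn-+ M M′ x j ⟨
      nbrsIn (M +ᴹ M′) c x j        ≡⟨ eqMM′ i j x y cx cy ⟩
      nbrsIn (M +ᴹ M′) c y j        ≡⟨ nbrsIn-+ M M′ y j ⟩
      nbrsIn M c y j + nbrsIn M′ c y j ∎)

  IsEquitable-· : ∀ k (M : Matrix N) → IsEquitable M c → IsEquitable (k ·ᴹ M) c
  IsEquitable-· k M eqM i j x y cx cy = begin
    nbrsIn (k ·ᴹ M) c x j ≡⟨ nbrsIn-· k M x j ⟩
    k * nbrsIn M c x j    ≡⟨ cong (k *_) (eqM i j x y cx cy) ⟩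
    k * nbrsIn M c y j    ≡⟨ nbrsIn-· k M y j ⟨
    nbrsIn (k ·ᴹ M) c y j ∎

  IsEquitable-Σᴹ : ∀ k (M : Fin k → Matrix N) → (∀ i → IsEquitable (M i) c) →
    IsEquitable (Σᴹ k M) c
  IsEquitable-Σᴹ zero    M eqM = λ _ _ _ _ _ _ → refl
  IsEquitable-Σᴹ (suc k) M eqM =
    IsEquitable-+ (M zero) (Σᴹ k (M ∘ suc)) (eqM zero) (IsEquitable-Σᴹ k (M ∘ suc) (eqM ∘ suc))

  IsEquitable-I : IsEquitable (I N) c
  IsEquitable-I i j x y cx cy = begin
    nbrsIn (I N) c x j ≡⟨ δ-sumˡ N x (λ v → δ (c v) j) ⟩
    δ (c x) j          ≡⟨ cong (λ a → δ a j) (trans cx (sym cy)) ⟩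
    δ (c y) j          ≡⟨ δ-sumˡ N y (λ v → δ (c v) j) ⟨
    nbrsIn (I N) c y j ∎

  IsEquitable-J : IsEquitable (J N) c
  IsEquitable-J _ _ _ _ _ _ = refl

Ā+I+A≡J : ∀ (Γ : Graph) x y → (Ā Γ +ᴹ (I (n Γ) +ᴹ A Γ)) x y ≡ J (n Γ) x y
Ā+I+A≡J Γ x y with x ≟ᶠ y
... | yes refl rewrite loopless Γ x = refl
... | no _ with adj Γ x y
...   | true  = refl
...   | false = refl

IsEquitable-Mat : ∀ (Γ : Graph) {t} (c : Fin (n Γ) → Fin t) → IsEquitable (A Γ) c →
  ∀ a → IsEquitable (Mat Γ a) c
IsEquitable-Mat Γ c eqA zero             = IsEquitable-I c
IsEquitable-Mat Γ c eqA (suc zero)       = eqA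
IsEquitable-Mat Γ c eqA (suc (suc zero)) =
  IsEquitable-+-cancelʳ c (Ā Γ) (I (n Γ) +ᴹ A Γ)
    (IsEquitable-cong c (λ x y → sym (Ā+I+A≡J Γ x y)) (IsEquitable-J c))
    (IsEquitable-+ c (I (n Γ)) (A Γ) (IsEquitable-I c) eqA)

module _ {N M t : ℕ} (c : Fin N → Fin t) where

  liftPartition-combine : ∀ y z → liftPartition {N} {M} c (combine y z) ≡ combine (c y) z
  liftPartition-combine y z = cong (λ r → combine (c (proj₁ r)) (proj₂ r)) (remQuot-combine y z)

  liftPartition-combine-injective : ∀ x w x′ w′ →
    liftPartition {N} {M} c (combine x w) ≡ liftPartition c (combine x′ w′) → c x ≡ c x′ × w ≡ w′
  liftPartition-combine-injective x w x′ w′ same = combine-injective (c x) w (c x′) w′ (begin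
    combine (c x) w                ≡⟨ liftPartition-combine x w ⟨
    liftPartition c (combine x w)   ≡⟨ same ⟩
    liftPartition c (combine x′ w′) ≡⟨ liftPartition-combine x′ w′ ⟩
    combine (c x′) w′              ∎)

  IsPartition-lift : IsPartition c → IsPartition (liftPartition {N} {M} c)
  IsPartition-lift cover K with j , z , refl ← combine-surjective {t} {M} K
                           with x , refl ← cover j = combine x z , liftPartition-combine x z

  ⊗-combine : ∀ (P : Matrix N) (Q : Matrix M) x w y z →
    (P ⊗ Q) (combine x w) (combine y z) ≡ P x y * Q w z
  ⊗-combine P Q x w y z =
    cong₂ (λ r r′ → P (proj₁ r) (proj₁ r′) * Q (proj₂ r) (proj₂ r′))
      (remQuot-combine x w) (remQuot-combine y z)

  nbrsIn-⊗ : ∀ (P : Matrix N) (Q : Matrix M) x w j z →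
    nbrsIn (P ⊗ Q) (liftPartition {N} {M} c) (combine x w) (combine j z) ≡ nbrsIn P c x j * Q w z
  nbrsIn-⊗ P Q x w j z = begin
    nbrsIn (P ⊗ Q) (liftPartition c) (combine x w) (combine j z)
      ≡⟨ ΣFin-combine N M _ ⟩
    ΣFin N (λ y → ΣFin M (λ z′ →
      (P ⊗ Q) (combine x w) (combine y z′) * δ (liftPartition c (combine y z′)) (combine j z)))
      ≡⟨ ΣFin-cong N (λ y → ΣFin-cong M (λ z′ → summand y z′)) ⟩
    ΣFin N (λ y → ΣFin M (λ z′ → (P x y * δ (c y) j) * (Q w z′ * δ z′ z)))
      ≡⟨ ΣFin-*-ΣFin N M _ _ ⟩
    nbrsIn P c x j * ΣFin M (λ z′ → Q w z′ * δ z′ z)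
      ≡⟨ cong (nbrsIn P c x j *_) (δ-sumʳ M z (Q w)) ⟩
    nbrsIn P c x j * Q w z ∎
    where
    summand : ∀ y z′ →
      (P ⊗ Q) (combine x w) (combine y z′) * δ (liftPartition c (combine y z′)) (combine j z)
        ≡ (P x y * δ (c y) j) * (Q w z′ * δ z′ z)
    summand y z′ = begin
      (P ⊗ Q) (combine x w) (combine y z′) * δ (liftPartition c (combine y z′)) (combine j z)
        ≡⟨ cong₂ _*_ (⊗-combine P Q x w y z′)
             (cong (λ K → δ K (combine j z)) (liftPartition-combine y z′)) ⟩
      P x y * Q w z′ * δ (combine (c y) z′) (combine j z)
        ≡⟨ cong (P x y * Q w z′ *_) (δ-combine (c y) j z′ z) ⟩
      P x y * Q w z′ * (δ (c y) j * δ z′ z)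
        ≡⟨ *-interchange (P x y) (Q w z′) (δ (c y) j) (δ z′ z) ⟩
      (P x y * δ (c y) j) * (Q w z′ * δ z′ z) ∎

  IsEquitable-⊗ : ∀ (P : Matrix N) (Q : Matrix M) → IsEquitable P c →
    IsEquitable (P ⊗ Q) (liftPartition {N} {M} c)
  IsEquitable-⊗ P Q eqP i K u v cu cv
    with x , w , refl ← combine-surjective {N} {M} u
    with x′ , w′ , refl ← combine-surjective {N} {M} v
    with j , z , refl ← combine-surjective {t} {M} K
    with cx≡cx′ , refl ← liftPartition-combine-injective x w x′ w′ (trans cu (sym cv)) = begin
      nbrsIn (P ⊗ Q) (liftPartition c) (combine x w) (combine j z)  ≡⟨ nbrsIn-⊗ P Q x w j z ⟩
      nbrsIn P c x j * Q w z   ≡⟨ cong (_* Q w z) (eqP (c x) j x x′ refl (sym cx≡cx′)) ⟩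
      nbrsIn P c x′ j * Q w z  ≡⟨ nbrsIn-⊗ P Q x′ w j z ⟨
      nbrsIn (P ⊗ Q) (liftPartition c) (combine x′ w) (combine j z) ∎

lemma3p1 : (Γ Δ : Graph) (s : Type) → s zero zero ≡ false →
    (t : ℕ) (c : Fin (n Γ) → Fin t) →
    IsEquitablePartition (A Γ) c →
    IsEquitablePartition (productMatrix s Γ Δ) (liftPartition {n Γ} {n Δ} {t} c)
-- The hypothesis s₀₀ = 0 only makes the product loopless; equitability does not need it.
lemma3p1 Γ Δ s _ t c (cover , eqA) = IsPartition-lift c cover ,
  IsEquitable-Σᴹ c′ 3 (λ a → Σᴹ 3 (term a)) (λ a → IsEquitable-Σᴹ c′ 3 (term a) (λ b →
    IsEquitable-· c′ (b2n (s a b)) (Mat Γ a ⊗ Mat Δ b)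
      (IsEquitable-⊗ c (Mat Γ a) (Mat Δ b) (IsEquitable-Mat Γ c eqA a))))
  where
  c′ : Fin (n Γ * n Δ) → Fin (t * n Δ)
  c′ = liftPartition {n Γ} {n Δ} {t} c
  term : Fin 3 → Fin 3 → Matrix (n Γ * n Δ)
  term a b = b2n (s a b) ·ᴹ (Mat Γ a ⊗ Mat Δ b)
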